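{- In Bochvar-Kleene logic: (1) there is no formula $C(p,q)$ whose propositional variables are exactly the distinct variables $p,q$ such that, for all formulas $\Gamma\cup\{\varphi,\psi,\gamma\}$, $\Gamma,C(\varphi,\psi)\vdash_{\mathrm{BK}}\gamma$ implies both $\Gamma,\varphi\vdash_{\mathrm{BK}}\gamma$ and $\Gamma,\psi\vdash_{\mathrm{BK}}\gamma$; (2) there is no formula $C(p,q)$ whose propositional variables are exactly $p,q$ such that, for all formulas $\Gamma\cup\{\varphi,\psi\}$, $\Gamma,\varphi\vdash_{\mathrm{BK}}\psi$ implies $\Gamma\vdash_{\mathrm{BK}}C(\varphi,\psi)$.
   Context: Formulas are built from a countably infinite set of variables with binary $\land,\lor$ and unary $\neg$; $C(\varphi,\psi)$ is the result of substituting $\varphi$ for $p$ and $\psi$ for $q$ in $C(p,q)$. $\mathbf A$ is the algebra on $\{f,u,t\}$ with connectives acting classically ($f$ false, $t$ true) on $\{f,t\}$-arguments and returning $u$ whenever some argument is $u$. $\Gamma\vdash_{\mathrm{BK}}\varphi$ iff there is no homomorphism $v$ into $\mathbf A$ with $v[\Gamma]\subseteq\{t\}$ and $v(\varphi)\ne t$. -}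

module Defs where

open import Data.Nat using (ℕ; _≟_)
open import Data.Product using (Σ; _×_; _,_)
open import Data.Sum using (_⊎_)
open import Data.Empty using (⊥)
open import Relation.Nullary using (¬_; yes; no)
open import Relation.Binary.PropositionalEquality using (_≡_; _≢_)

data Formula : Set where
  var  : ℕ → Formula
  _∧_  : Formula → Formula → Formula
  _∨_  : Formula → Formula → Formula
  ¬'_  : Formula → Formula

data V3 : Set where
  f u t : V3

not₃ : V3 → V3
not₃ f = t
not₃ u = u
not₃ t = f

and₃ : V3 → V3 → V3
and₃ u _ = u
and₃ _ u = u
and₃ t t = t
and₃ t f = f
and₃ f t = f
and₃ f f = f

or₃ : V3 → V3 → V3
or₃ u _ = u
or₃ _ u = u
or₃ f f = f
or₃ f t = t
or₃ t f = t
or₃ t t = t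

-- Homomorphisms from the formula algebra into A are exactly the
-- extensions of valuations of the variables.
Valuation : Set
Valuation = ℕ → V3

⟦_⟧ : Formula → Valuation → V3
⟦ var n ⟧ v = v n
⟦ φ ∧ ψ ⟧ v = and₃ (⟦ φ ⟧ v) (⟦ ψ ⟧ v)
⟦ φ ∨ ψ ⟧ v = or₃ (⟦ φ ⟧ v) (⟦ ψ ⟧ v)
⟦ ¬' φ ⟧ v = not₃ (⟦ φ ⟧ v)

FSet : Set₁
FSet = Formula → Set

_,,_ : FSet → Formula → FSet
(Γ ,, φ) ψ = Γ ψ ⊎ ψ ≡ φ

_⊢BK_ : FSet → Formula → Set
Γ ⊢BK φ = ¬ (Σ Valuation λ v → ((ψ : Formula) → Γ ψ → ⟦ ψ ⟧ v ≡ t) × ⟦ φ ⟧ v ≢ t)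

data Occurs (n : ℕ) : Formula → Set where
  here : Occurs n (var n)
  ∧ˡ : ∀ {φ ψ} → Occurs n φ → Occurs n (φ ∧ ψ)
  ∧ʳ : ∀ {φ ψ} → Occurs n ψ → Occurs n (φ ∧ ψ)
  ∨ˡ : ∀ {φ ψ} → Occurs n φ → Occurs n (φ ∨ ψ)
  ∨ʳ : ∀ {φ ψ} → Occurs n ψ → Occurs n (φ ∨ ψ)
  ¬o : ∀ {φ} → Occurs n φ → Occurs n (¬' φ)

VarsExactly : Formula → ℕ → ℕ → Set
VarsExactly C p q = (r : ℕ) → (Occurs r C → (r ≡ p ⊎ r ≡ q)) × ((r ≡ p ⊎ r ≡ q) → Occurs r C)

-- C(φ, ψ): simultaneous substitution of φ for p and ψ for q
subst₂ : ℕ → ℕ → Formula → Formula → Formula → Formula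
subst₂ p q φ ψ (var n) with n ≟ p
... | yes _ = φ
... | no _ with n ≟ q
...   | yes _ = ψ
...   | no _ = var n
subst₂ p q φ ψ (A ∧ B) = subst₂ p q φ ψ A ∧ subst₂ p q φ ψ B
subst₂ p q φ ψ (A ∨ B) = subst₂ p q φ ψ A ∨ subst₂ p q φ ψ B
subst₂ p q φ ψ (¬' A) = ¬' subst₂ p q φ ψ A

-- Every connective of A returns u as soon as one argument is u, so a formula is
-- u under any valuation sending one of its variables to u.  Hence BK has no
-- theorems (all variables u), which refutes (2) with φ = ψ = p.  For (1), the
-- identity substitution makes C(p, q) ⊢ C(p, q) trivial, yet p ⊬ C(p, q):
-- send p to t and every other variable, in particular q, to u.
module Submission where

open import Defs
open import Data.Nat using (ℕ; _≟_)
open import Data.Product using (_×_; _,_; proj₁; proj₂)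
open import Data.Sum using (inj₁; inj₂)
open import Data.Empty using (⊥-elim)
open import Relation.Nullary using (¬_; yes; no)
open import Relation.Unary using (∅)
open import Relation.Binary.PropositionalEquality using (_≡_; _≢_; refl; sym; trans; cong; cong₂; subst)

and₃-zeroʳ : ∀ x → and₃ x u ≡ u
and₃-zeroʳ f = refl
and₃-zeroʳ u = refl
and₃-zeroʳ t = refl

or₃-zeroʳ : ∀ x → or₃ x u ≡ u
or₃-zeroʳ f = refl
or₃-zeroʳ u = refl
or₃-zeroʳ t = refl

⟦⟧-infectious : ∀ {n φ} (v : Valuation) → v n ≡ u → Occurs n φ → ⟦ φ ⟧ v ≡ u
⟦⟧-infectious v vn≡u here = vn≡u
⟦⟧-infectious v vn≡u (∧ˡ o) rewrite ⟦⟧-infectious v vn≡u o = refl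
⟦⟧-infectious v vn≡u (∧ʳ {φ} o) rewrite ⟦⟧-infectious v vn≡u o = and₃-zeroʳ (⟦ φ ⟧ v)
⟦⟧-infectious v vn≡u (∨ˡ o) rewrite ⟦⟧-infectious v vn≡u o = refl
⟦⟧-infectious v vn≡u (∨ʳ {φ} o) rewrite ⟦⟧-infectious v vn≡u o = or₃-zeroʳ (⟦ φ ⟧ v)
⟦⟧-infectious v vn≡u (¬o o) rewrite ⟦⟧-infectious v vn≡u o = refl

⟦⟧-allU : ∀ φ → ⟦ φ ⟧ (λ _ → u) ≡ u
⟦⟧-allU (var n) = refl
⟦⟧-allU (φ ∧ ψ) rewrite ⟦⟧-allU φ = refl
⟦⟧-allU (φ ∨ ψ) rewrite ⟦⟧-allU φ = refl
⟦⟧-allU (¬' φ) rewrite ⟦⟧-allU φ = refl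

subst₂-id : ∀ p q C → subst₂ p q (var p) (var q) C ≡ C
subst₂-id p q (var n) with n ≟ p
... | yes refl = refl
... | no _ with n ≟ q
...   | yes refl = refl
...   | no _ = refl
subst₂-id p q (A ∧ B) = cong₂ _∧_ (subst₂-id p q A) (subst₂-id p q B)
subst₂-id p q (A ∨ B) = cong₂ _∨_ (subst₂-id p q A) (subst₂-id p q B)
subst₂-id p q (¬' A) = cong ¬'_ (subst₂-id p q A)

u≢t : u ≢ t
u≢t ()

⊢BK-refl : ∀ Γ φ → (Γ ,, φ) ⊢BK φ
⊢BK-refl Γ φ (v , Γ,φ-true , φ≢t) = φ≢t (Γ,φ-true φ (inj₂ refl))

no-theorems : ∀ φ → ¬ (∅ ⊢BK φ)
no-theorems φ ⊢φ = ⊢φ ((λ _ → u) , (λ _ ()) , λ φ≡t → u≢t (trans (sym (⟦⟧-allU φ)) φ≡t))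

trueOnlyAt : ℕ → Valuation
trueOnlyAt p n with n ≟ p
... | yes _ = t
... | no _ = u

trueOnlyAt-self : ∀ p → trueOnlyAt p p ≡ t
trueOnlyAt-self p with p ≟ p
... | yes _ = refl
... | no p≢p = ⊥-elim (p≢p refl)

trueOnlyAt-other : ∀ {p q} → p ≢ q → trueOnlyAt p q ≡ u
trueOnlyAt-other {p} {q} p≢q with q ≟ p
... | yes q≡p = ⊥-elim (p≢q (sym q≡p))
... | no _ = refl

var⊬-if-other-var-occurs : ∀ {p q C} → p ≢ q → Occurs q C → ¬ ((∅ ,, var p) ⊢BK C)
var⊬-if-other-var-occurs {p} {q} {C} p≢q q∈C p⊢C = p⊢C (trueOnlyAt p , premise-true , C≢t)
  where
  premise-true : ∀ φ → (∅ ,, var p) φ → ⟦ φ ⟧ (trueOnlyAt p) ≡ t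
  premise-true .(var p) (inj₂ refl) = trueOnlyAt-self p

  C≢t : ⟦ C ⟧ (trueOnlyAt p) ≢ t
  C≢t C≡t = u≢t (trans (sym (⟦⟧-infectious (trueOnlyAt p) (trueOnlyAt-other p≢q) q∈C)) C≡t)

no-disjunction : (p q : ℕ) → p ≢ q → (C : Formula) → VarsExactly C p q →
                 ¬ ((Γ : FSet) (φ ψ γ : Formula) →
                      (Γ ,, subst₂ p q φ ψ C) ⊢BK γ →
                      ((Γ ,, φ) ⊢BK γ) × ((Γ ,, ψ) ⊢BK γ))
no-disjunction p q p≢q C vars elim = p⊬C (proj₁ (elim ∅ (var p) (var q) C Cpq⊢C))
  where
  Cpq⊢C : (∅ ,, subst₂ p q (var p) (var q) C) ⊢BK C
  Cpq⊢C = subst (λ X → (∅ ,, X) ⊢BK C) (sym (subst₂-id p q C)) (⊢BK-refl ∅ C)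

  p⊬C : ¬ ((∅ ,, var p) ⊢BK C)
  p⊬C = var⊬-if-other-var-occurs p≢q (proj₂ (vars q) (inj₂ refl))

no-deduction-implication : (p q : ℕ) → p ≢ q → (C : Formula) → VarsExactly C p q →
                           ¬ ((Γ : FSet) (φ ψ : Formula) →
                                (Γ ,, φ) ⊢BK ψ → Γ ⊢BK subst₂ p q φ ψ C)
no-deduction-implication p q _ C _ intro =
  no-theorems (subst₂ p q (var p) (var p) C) (intro ∅ (var p) (var p) (⊢BK-refl ∅ (var p)))

proposition3 : ((p q : ℕ) → p ≢ q → (C : Formula) → VarsExactly C p q →
                  ¬ ((Γ : FSet) (φ ψ γ : Formula) →
                       (Γ ,, subst₂ p q φ ψ C) ⊢BK γ →
                       ((Γ ,, φ) ⊢BK γ) × ((Γ ,, ψ) ⊢BK γ)))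
               × ((p q : ℕ) → p ≢ q → (C : Formula) → VarsExactly C p q →
                  ¬ ((Γ : FSet) (φ ψ : Formula) →
                       (Γ ,, φ) ⊢BK ψ → Γ ⊢BK subst₂ p q φ ψ C))
proposition3 = no-disjunction , no-deduction-implication
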